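{- Let $S_1,S_2,\ldots,S_k$ be numerical semigroups and let $S = \bigcap_{i=1}^k S_i$. Suppose that $d_i \in S_i \setminus \{0\}$ for $i=1,2,\ldots,k$. Then there exists an $A\in \mathsf{M}_{d_1+d_2+\cdots + d_k}(\mathbb{Q})$ such that $\mathcal{S}(A) = S$. In particular, $\operatorname{dim_{mat}} S \leq d_1 + d_2 + \cdots + d_k$.
   Context: $\mathbb{N} = \{0,1,2,\ldots\}$. A numerical semigroup is an additive subsemigroup of $\mathbb{N}$ containing $0$ whose complement in $\mathbb{N}$ is finite. $\mathsf{M}_d(X)$ denotes the set of $d\times d$ matrices with entries in $X$. For $A \in \mathsf{M}_d(\mathbb{Q})$, $\mathcal{S}(A) = \{ n \in \mathbb{N} : A^n \in \mathsf{M}_d(\mathbb{Z})\}$. The matricial dimension $\operatorname{dim_{mat}} S$ of a semigroup $S$ is the smallest $d$ such that $S = \mathcal{S}(A)$ for some $A \in \mathsf{M}_d(\mathbb{Q})$. -}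

module Defs where

open import Level using (0ℓ)
open import Data.Nat using (ℕ; zero; suc; _+_; _≤_)
open import Data.Fin using (Fin; zero; suc; _≟_)
open import Data.Integer using (ℤ)
open import Data.Rational using (ℚ; 0ℚ; 1ℚ) renaming (_+_ to _+ℚ_; _*_ to _*ℚ_)
import Data.Rational as ℚ
open import Data.Product using (Σ; _×_)
open import Relation.Binary.PropositionalEquality using (_≡_)
open import Relation.Nullary using (Dec; yes; no)
open import Relation.Unary using (Pred; Decidable)

-- Numerical semigroup: a subset S ⊆ ℕ containing 0, closed under +,
-- with finite complement (all n ≥ some bound lie in S).
-- Membership is taken decidable (every subset of ℕ is, classically).
record NumericalSemigroup : Set₁ where
  field
    carrier   : Pred ℕ 0ℓ
    member?   : Decidable carrier
    has-zero  : carrier 0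
    closed    : ∀ {m n} → carrier m → carrier n → carrier (m + n)
    cofinite  : Σ ℕ λ N → ∀ n → N ≤ n → carrier n

open NumericalSemigroup public

∑ : ∀ {k} → (Fin k → ℕ) → ℕ
∑ {zero}  f = 0
∑ {suc k} f = f zero + ∑ (λ i → f (suc i))

∑ℚ : ∀ {k} → (Fin k → ℚ) → ℚ
∑ℚ {zero}  f = 0ℚ
∑ℚ {suc k} f = f zero +ℚ ∑ℚ (λ i → f (suc i))

Mat : Set → ℕ → Set
Mat X d = Fin d → Fin d → X

idMat : ∀ {d} → Mat ℚ d
idMat i j with i ≟ j
... | yes _ = 1ℚ
... | no  _ = 0ℚ

_⊗_ : ∀ {d} → Mat ℚ d → Mat ℚ d → Mat ℚ d
(A ⊗ B) i j = ∑ℚ (λ l → A i l *ℚ B l j)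

_^ᴹ_ : ∀ {d} → Mat ℚ d → ℕ → Mat ℚ d
A ^ᴹ zero  = idMat
A ^ᴹ suc n = A ⊗ (A ^ᴹ n)

IsInt : ℚ → Set
IsInt q = Σ ℤ λ z → q ≡ z ℚ./ 1

IntegralMat : ∀ {d} → Mat ℚ d → Set
IntegralMat A = ∀ i j → IsInt (A i j)

𝒮 : ∀ {d} → Mat ℚ d → Pred ℕ 0ℓ
𝒮 A n = IntegralMat (A ^ᴹ n)

{-# OPTIONS --safe #-}
-- Let step be a self-map of Fin D and h : Fin D → ℕ a height function. The
-- monomial matrix with entry 2^(1 + h x − h (step x)) at (x, step x) has as
-- n-th power the monomial matrix with entry 2^(n + h x − h (stepⁿ x)) at
-- (x, stepⁿ x), so it is integral exactly when h (stepⁿ x) ≤ n + h x for all x.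
-- For a numerical semigroup S and 0 ≠ d ∈ S, let step be i ↦ i + 1 on residues
-- mod d and h i the least element of S congruent to i (the Apéry set of S with
-- respect to d). Since h 0 = 0, the condition at x = 0 says that the least
-- element of S congruent to n is at most n, i.e. n ∈ S; conversely n ∈ S gives
-- h x + n ∈ S, whence the condition at every x. Block sums of these maps then
-- realise the intersection of the Sᵢ in dimension d₁ + ⋯ + dₖ.
module Submission where

open import Defs
open import Data.Nat
  using (ℕ; zero; suc; _+_; _*_; _∸_; _≤_; _≤?_; NonZero; ≢-nonZero; >-nonZero⁻¹)
import Data.Nat as ℕ using (_≟_)
open import Data.Nat.Properties
  using ( +-suc; +-comm; +-assoc; +-identityʳ; *-distribʳ-+; ≤-trans; ≮⇒≥; ≰⇒>
        ; n≤0⇒n≡0; m≤m*n; m≤n+m; m+[n∸m]≡n; m≤n⇒∃[o]m+o≡n )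
open import Data.Nat.DivMod
  using ( _%_; _/_; _mod_; m≡m%n+[m/n]*n; %-distribˡ-+; m%n%n≡m%n; m%n<n
        ; m<n⇒m%n≡m; [m+kn]%n≡m%n; /-monoˡ-≤ )
open import Data.Nat.Coprimality using (1-coprimeTo) renaming (sym to coprime-sym)
open import Data.Nat.GeneralisedArithmetic using (iterate)
open import Data.Fin
  using (Fin; zero; suc; _≟_; toℕ; fromℕ; fromℕ<; _↑ˡ_; _↑ʳ_; splitAt; join)
open import Data.Fin.Properties
  using ( suc-injective; splitAt-↑ˡ; splitAt-↑ʳ; join-splitAt; ¬∀⟶∃¬-smallest
        ; toℕ-fromℕ; toℕ-fromℕ<; toℕ-inject; toℕ<n )
import Data.Integer as ℤ
open import Data.Rational as ℚ using (ℚ; mkℚ; 0ℚ; 1ℚ; ½; ↧ₙ_)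
  renaming (_+_ to _+ℚ_; _*_ to _*ℚ_)
import Data.Rational.Properties as ℚ
open import Data.Rational.Solver using (module +-*-Solver)
open import Algebra.Bundles using (CommutativeRing)
open import Algebra.Properties.CommutativeSemiring.Exp
  (CommutativeRing.commutativeSemiring ℚ.+-*-commutativeRing) using (_^_; ^-homo-*; ^-distrib-*)
open import Data.Sum using (inj₁; inj₂; [_,_]′)
import Data.Sum as Sum
open import Data.Product using (Σ; ∃; _×_; _,_; proj₁; proj₂)
open import Relation.Binary.PropositionalEquality
open import Relation.Nullary using (¬_; ¬?; yes; no; contradiction)
open import Relation.Nullary.Decidable using (decidable-stable; _×-dec_)
open import Relation.Unary using (Pred; Decidable; ∁)
open import Function.Base using (_∘_)
open import Function.Bundles using (_⇔_; mk⇔; module Equivalence)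
open import Function.Related.Propositional using (module EquationalReasoning)

open +-*-Solver using (solve; _:*_; _:=_)

-- z / 1 does not compute for a variable z (normalisation takes a gcd); mkℚ z 0 does.
fromℤ≡mkℚ : ∀ z → z ℚ./ 1 ≡ mkℚ z 0 (coprime-sym (1-coprimeTo ℤ.∣ z ∣))
fromℤ≡mkℚ (ℤ.+ n)    = ℚ.normalize-coprime _
fromℤ≡mkℚ ℤ.-[1+ n ] = cong ℚ.-_ (ℚ.normalize-coprime (coprime-sym (1-coprimeTo (suc n))))

isInt-* : ∀ {p q} → IsInt p → IsInt q → IsInt (p *ℚ q)
isInt-* (a , refl) (b , refl) = a ℤ.* b , fromℤ-*
  where
  fromℤ-* : (a ℚ./ 1) *ℚ (b ℚ./ 1) ≡ (a ℤ.* b) ℚ./ 1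
  fromℤ-* rewrite fromℤ≡mkℚ a | fromℤ≡mkℚ b = refl

¬isInt-½ : ¬ IsInt ½
¬isInt-½ (z , eq) with cong ↧ₙ_ (trans eq (fromℤ≡mkℚ z))
... | ()

two : ℚ
two = ℤ.+ 2 ℚ./ 1

isInt-2^ : ∀ n → IsInt (two ^ n)
isInt-2^ zero    = ℤ.+ 1 , refl
isInt-2^ (suc n) = isInt-* (ℤ.+ 2 , refl) (isInt-2^ n)

2^n*½^n≡1 : ∀ n → two ^ n *ℚ ½ ^ n ≡ 1ℚ
2^n*½^n≡1 n = trans (sym (^-distrib-* two ½ n)) (1^n≡1 n)
  where
  1^n≡1 : ∀ n → 1ℚ ^ n ≡ 1ℚ
  1^n≡1 zero    = refl
  1^n≡1 (suc n) = trans (ℚ.*-identityˡ _) (1^n≡1 n)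

2^[m+n]*½^m≡2^n : ∀ m n → two ^ (m + n) *ℚ ½ ^ m ≡ two ^ n
2^[m+n]*½^m≡2^n m n = begin
  two ^ (m + n) *ℚ ½ ^ m
    ≡⟨ cong (_*ℚ ½ ^ m) (^-homo-* two m n) ⟩
  two ^ m *ℚ two ^ n *ℚ ½ ^ m
    ≡⟨ solve 3 (λ x y z → x :* y :* z := y :* (x :* z)) refl (two ^ m) (two ^ n) (½ ^ m) ⟩
  two ^ n *ℚ (two ^ m *ℚ ½ ^ m)
    ≡⟨ cong (two ^ n *ℚ_) (2^n*½^n≡1 m) ⟩
  two ^ n *ℚ 1ℚ
    ≡⟨ ℚ.*-identityʳ _ ⟩
  two ^ n
    ∎
  where open ≡-Reasoning

2^m*½^[1+m+n]*2^n≡½ : ∀ m n → two ^ m *ℚ ½ ^ suc (m + n) *ℚ two ^ n ≡ ½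
2^m*½^[1+m+n]*2^n≡½ m n = begin
  two ^ m *ℚ (½ *ℚ ½ ^ (m + n)) *ℚ two ^ n
    ≡⟨ solve 4 (λ x h y z → x :* (h :* z) :* y := h :* (x :* y :* z)) refl (two ^ m) ½ (two ^ n) (½ ^ (m + n)) ⟩
  ½ *ℚ (two ^ m *ℚ two ^ n *ℚ ½ ^ (m + n))
    ≡⟨ cong (λ t → ½ *ℚ (t *ℚ ½ ^ (m + n))) (^-homo-* two m n) ⟨
  ½ *ℚ (two ^ (m + n) *ℚ ½ ^ (m + n))
    ≡⟨ cong (½ *ℚ_) (2^n*½^n≡1 (m + n)) ⟩
  ½ *ℚ 1ℚ
    ≡⟨ ℚ.*-identityʳ ½ ⟩
  ½
    ∎
  where open ≡-Reasoning

isInt-2^*½^ : ∀ a b → IsInt (two ^ a *ℚ ½ ^ b) ⇔ b ≤ a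
isInt-2^*½^ a b = mk⇔ to from
  where
  from : b ≤ a → IsInt (two ^ a *ℚ ½ ^ b)
  from b≤a with m≤n⇒∃[o]m+o≡n b≤a
  ... | k , refl = subst IsInt (sym (2^[m+n]*½^m≡2^n b k)) (isInt-2^ k)
  to : IsInt (two ^ a *ℚ ½ ^ b) → b ≤ a
  to int with b ≤? a
  ... | yes b≤a = b≤a
  ... | no  b≰a with m≤n⇒∃[o]m+o≡n (≰⇒> b≰a)
  ...   | k , refl =
    contradiction (subst IsInt (2^m*½^[1+m+n]*2^n≡½ a k) (isInt-* int (isInt-2^ k))) ¬isInt-½

∑ℚ-zero : ∀ {D} (f : Fin D → ℚ) → (∀ l → f l ≡ 0ℚ) → ∑ℚ f ≡ 0ℚ
∑ℚ-zero {zero}  f f≡0 = refl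
∑ℚ-zero {suc D} f f≡0 = begin
  f zero +ℚ ∑ℚ (λ l → f (suc l))  ≡⟨ cong₂ _+ℚ_ (f≡0 zero) (∑ℚ-zero (f ∘ suc) (f≡0 ∘ suc)) ⟩
  0ℚ +ℚ 0ℚ                        ≡⟨⟩
  0ℚ                             ∎
  where open ≡-Reasoning

∑ℚ-single : ∀ {D} (f : Fin D → ℚ) (m : Fin D) → (∀ l → l ≢ m → f l ≡ 0ℚ) → ∑ℚ f ≡ f m
∑ℚ-single {suc D} f zero    f≡0 = begin
  f zero +ℚ ∑ℚ (λ l → f (suc l))  ≡⟨ cong (f zero +ℚ_) (∑ℚ-zero (f ∘ suc) (λ l → f≡0 (suc l) λ ())) ⟩
  f zero +ℚ 0ℚ                    ≡⟨ ℚ.+-identityʳ (f zero) ⟩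
  f zero                         ∎
  where open ≡-Reasoning
∑ℚ-single {suc D} f (suc m) f≡0 = begin
  f zero +ℚ ∑ℚ (λ l → f (suc l))  ≡⟨ cong₂ _+ℚ_ (f≡0 zero λ ()) (∑ℚ-single (f ∘ suc) m off-support) ⟩
  0ℚ +ℚ f (suc m)                 ≡⟨ ℚ.+-identityˡ (f (suc m)) ⟩
  f (suc m)                      ∎
  where
  open ≡-Reasoning
  off-support : ∀ l → l ≢ m → f (suc l) ≡ 0ℚ
  off-support l l≢m = f≡0 (suc l) (l≢m ∘ suc-injective)

monomial : ∀ {D} → (Fin D → Fin D) → (Fin D → ℚ) → Mat ℚ D
monomial f w i j with f i ≟ j
... | yes _ = w i
... | no  _ = 0ℚ

monomial-diagonal : ∀ {D} (f : Fin D → Fin D) (w : Fin D → ℚ) i → monomial f w i (f i) ≡ w i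
monomial-diagonal f w i with f i ≟ f i
... | yes _     = refl
... | no  fi≢fi = contradiction refl fi≢fi

*-monomial-∘ : ∀ {D} (f g : Fin D → Fin D) (w v : Fin D → ℚ) i j →
               w i *ℚ monomial g v (f i) j ≡ monomial (g ∘ f) (λ x → w x *ℚ v (f x)) i j
*-monomial-∘ f g w v i j with g (f i) ≟ j
... | yes _ = refl
... | no  _ = ℚ.*-zeroʳ (w i)

monomial-⊗ : ∀ {D} (f : Fin D → Fin D) (w : Fin D → ℚ) (B : Mat ℚ D) i j →
             (monomial f w ⊗ B) i j ≡ w i *ℚ B (f i) j
monomial-⊗ f w B i j = trans (∑ℚ-single _ (f i) off-support) (cong (_*ℚ B (f i) j) (monomial-diagonal f w i))
  where
  off-support : ∀ l → l ≢ f i → monomial f w i l *ℚ B l j ≡ 0ℚ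
  off-support l l≢fi with f i ≟ l
  ... | yes fi≡l = contradiction (sym fi≡l) l≢fi
  ... | no  _    = ℚ.*-zeroˡ (B l j)

orbitProduct : ∀ {D} → (Fin D → Fin D) → (Fin D → ℚ) → ℕ → Fin D → ℚ
orbitProduct f w zero    x = 1ℚ
orbitProduct f w (suc n) x = w x *ℚ orbitProduct f w n (f x)

monomial-^ᴹ : ∀ {D} (f : Fin D → Fin D) (w : Fin D → ℚ) n i j →
              (monomial f w ^ᴹ n) i j ≡ monomial (λ x → iterate f x n) (orbitProduct f w n) i j
monomial-^ᴹ f w zero i j with i ≟ j
... | yes _ = refl
... | no  _ = refl
monomial-^ᴹ f w (suc n) i j = begin
  (monomial f w ⊗ (monomial f w ^ᴹ n)) i j
    ≡⟨ monomial-⊗ f w (monomial f w ^ᴹ n) i j ⟩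
  w i *ℚ (monomial f w ^ᴹ n) (f i) j
    ≡⟨ cong (w i *ℚ_) (monomial-^ᴹ f w n (f i) j) ⟩
  w i *ℚ monomial (λ x → iterate f x n) (orbitProduct f w n) (f i) j
    ≡⟨ *-monomial-∘ f (λ x → iterate f x n) w (orbitProduct f w n) i j ⟩
  monomial (λ x → iterate f x (suc n)) (orbitProduct f w (suc n)) i j
    ∎
  where open ≡-Reasoning

integralMat-monomial : ∀ {D} (f : Fin D → Fin D) (w : Fin D → ℚ) →
                       IntegralMat (monomial f w) ⇔ (∀ i → IsInt (w i))
integralMat-monomial f w = mk⇔ to from
  where
  to : IntegralMat (monomial f w) → ∀ i → IsInt (w i)
  to int i = subst IsInt (monomial-diagonal f w i) (int i (f i))
  from : (∀ i → IsInt (w i)) → IntegralMat (monomial f w)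
  from int i j with f i ≟ j
  ... | yes _ = int i
  ... | no  _ = ℤ.+ 0 , refl

𝒮-monomial : ∀ {D} (f : Fin D → Fin D) (w : Fin D → ℚ) n →
             𝒮 (monomial f w) n ⇔ (∀ i → IsInt (orbitProduct f w n i))
𝒮-monomial f w n = mk⇔
  (λ int → to (λ i j → subst IsInt (monomial-^ᴹ f w n i j) (int i j)))
  (λ int i j → subst IsInt (sym (monomial-^ᴹ f w n i j)) (from int i j))
  where open Equivalence (integralMat-monomial (λ x → iterate f x n) (orbitProduct f w n))

record WeightedMap (D : ℕ) : Set where
  field
    step   : Fin D → Fin D
    height : Fin D → ℕ

open WeightedMap

AdmissibleAt : ∀ {D} → WeightedMap D → ℕ → Fin D → Set
AdmissibleAt s n x = height s (iterate (step s) x n) ≤ n + height s x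

Admissible : ∀ {D} → WeightedMap D → ℕ → Set
Admissible s n = ∀ x → AdmissibleAt s n x

rowWeight : ∀ {D} → WeightedMap D → Fin D → ℚ
rowWeight s x = two ^ suc (height s x) *ℚ ½ ^ height s (step s x)

matrix : ∀ {D} → WeightedMap D → Mat ℚ D
matrix s = monomial (step s) (rowWeight s)

orbitProduct-rowWeight : ∀ {D} (s : WeightedMap D) n x →
  orbitProduct (step s) (rowWeight s) n x ≡ two ^ (n + height s x) *ℚ ½ ^ height s (iterate (step s) x n)
orbitProduct-rowWeight s zero    x = sym (2^n*½^n≡1 (height s x))
orbitProduct-rowWeight s (suc n) x = begin
  (A *ℚ B) *ℚ orbitProduct (step s) (rowWeight s) n (step s x)
    ≡⟨ cong ((A *ℚ B) *ℚ_) (orbitProduct-rowWeight s n (step s x)) ⟩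
  (A *ℚ B) *ℚ (two ^ (n + h′) *ℚ E)
    ≡⟨ cong (λ t → (A *ℚ B) *ℚ (t *ℚ E)) (^-homo-* two n h′) ⟩
  (A *ℚ B) *ℚ ((C *ℚ W) *ℚ E)
    ≡⟨ solve 5 (λ a b c w e → (a :* b) :* ((c :* w) :* e) := ((c :* a) :* e) :* (w :* b)) refl A B C W E ⟩
  ((C *ℚ A) *ℚ E) *ℚ (W *ℚ B)
    ≡⟨ cong (((C *ℚ A) *ℚ E) *ℚ_) (2^n*½^n≡1 h′) ⟩
  ((C *ℚ A) *ℚ E) *ℚ 1ℚ
    ≡⟨ ℚ.*-identityʳ _ ⟩
  (C *ℚ A) *ℚ E
    ≡⟨ cong (_*ℚ E) (^-homo-* two n (suc (height s x))) ⟨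
  two ^ (n + suc (height s x)) *ℚ E
    ≡⟨ cong (λ k → two ^ k *ℚ E) (+-suc n (height s x)) ⟩
  two ^ (suc n + height s x) *ℚ E
    ∎
  where
  open ≡-Reasoning
  h′ = height s (step s x)
  A = two ^ suc (height s x)
  B = ½ ^ h′
  C = two ^ n
  W = two ^ h′
  E = ½ ^ height s (iterate (step s) x (suc n))

𝒮-matrix : ∀ {D} (s : WeightedMap D) n → 𝒮 (matrix s) n ⇔ Admissible s n
𝒮-matrix s n = mk⇔
  (λ int x → to (isInt-2^*½^ _ _) (subst IsInt (orbitProduct-rowWeight s n x) (to (𝒮-monomial _ _ n) int x)))
  (λ adm → from (𝒮-monomial _ _ n)
             (λ x → subst IsInt (sym (orbitProduct-rowWeight s n x)) (from (isInt-2^*½^ _ _) (adm x))))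
  where open Equivalence

iterate-commute : ∀ {A B : Set} {g : B → B} {h : A → A} (f : A → B) →
                  (∀ x → g (f x) ≡ f (h x)) → ∀ x n → iterate g (f x) n ≡ f (iterate h x n)
iterate-commute             f comm x zero    = refl
iterate-commute {g = g} {h} f comm x (suc n) =
  trans (cong (λ y → iterate g y n) (comm x)) (iterate-commute f comm (h x) n)

admissibleAt-embedding : ∀ {a c} (s : WeightedMap a) (t : WeightedMap c) (f : Fin a → Fin c) →
  (∀ x → step t (f x) ≡ f (step s x)) → (∀ x → height t (f x) ≡ height s x) →
  ∀ n x → AdmissibleAt t n (f x) ⇔ AdmissibleAt s n x
admissibleAt-embedding s t f step≡ height≡ n x =
  mk⇔ (subst₂ _≤_ orbit≡ start≡) (subst₂ _≤_ (sym orbit≡) (sym start≡))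
  where
  orbit≡ : height t (iterate (step t) (f x) n) ≡ height s (iterate (step s) x n)
  orbit≡ = trans (cong (height t) (iterate-commute f step≡ x n)) (height≡ _)
  start≡ : n + height t (f x) ≡ n + height s x
  start≡ = cong (n +_) (height≡ x)

_⊕_ : ∀ {a b} → WeightedMap a → WeightedMap b → WeightedMap (a + b)
_⊕_ {a} {b} s t = record
  { step   = join a b ∘ Sum.map (step s) (step t) ∘ splitAt a
  ; height = [ height s , height t ]′ ∘ splitAt a
  }

admissible-⊕ : ∀ {a b} (s : WeightedMap a) (t : WeightedMap b) n →
               Admissible (s ⊕ t) n ⇔ (Admissible s n × Admissible t n)
admissible-⊕ {a} {b} s t n = mk⇔
  (λ adm → (λ i → to (left i) (adm (i ↑ˡ b))) , (λ j → to (right j) (adm (a ↑ʳ j))))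
  (λ (adm-s , adm-t) x →
     subst (AdmissibleAt (s ⊕ t) n) (join-splitAt a b x) (joined adm-s adm-t (splitAt a x)))
  where
  open Equivalence
  left : ∀ i → AdmissibleAt (s ⊕ t) n (i ↑ˡ b) ⇔ AdmissibleAt s n i
  left = admissibleAt-embedding s (s ⊕ t) (_↑ˡ b)
           (λ i → cong (join a b ∘ Sum.map (step s) (step t)) (splitAt-↑ˡ a i b))
           (λ i → cong [ height s , height t ]′ (splitAt-↑ˡ a i b)) n
  right : ∀ j → AdmissibleAt (s ⊕ t) n (a ↑ʳ j) ⇔ AdmissibleAt t n j
  right = admissibleAt-embedding t (s ⊕ t) (a ↑ʳ_)
            (λ j → cong (join a b ∘ Sum.map (step s) (step t)) (splitAt-↑ʳ a b j))
            (λ j → cong [ height s , height t ]′ (splitAt-↑ʳ a b j)) n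
  joined : Admissible s n → Admissible t n → ∀ y → AdmissibleAt (s ⊕ t) n (join a b y)
  joined adm-s adm-t (inj₁ i) = from (left i) (adm-s i)
  joined adm-s adm-t (inj₂ j) = from (right j) (adm-t j)

⨁ : ∀ {k} {d : Fin k → ℕ} → ((i : Fin k) → WeightedMap (d i)) → WeightedMap (∑ d)
⨁ {zero}  s = record { step = λ () ; height = λ () }
⨁ {suc k} s = s zero ⊕ ⨁ (s ∘ suc)

admissible-⨁ : ∀ {k} {d : Fin k → ℕ} (s : (i : Fin k) → WeightedMap (d i)) n →
               Admissible (⨁ s) n ⇔ (∀ i → Admissible (s i) n)
admissible-⨁ {zero}  s n = mk⇔ (λ _ ()) (λ _ ())
admissible-⨁ {suc k} s n = mk⇔
  (λ adm → let (adm₀ , adm₊) = to (admissible-⊕ _ _ n) adm in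
    λ { zero → adm₀ ; (suc i) → to (admissible-⨁ (s ∘ suc) n) adm₊ i })
  (λ adm → from (admissible-⊕ _ _ n) (adm zero , from (admissible-⨁ (s ∘ suc) n) (adm ∘ suc)))
  where open Equivalence

least : ∀ {p} {P : Pred ℕ p} → Decidable P → ∀ {x} → P x → Σ ℕ λ m → P m × (∀ {k} → P k → m ≤ k)
-- The least witness is the smallest counterexample in Fin (suc x) to "P fails everywhere".
least {P = P} P? {x} Px
  with ¬∀⟶∃¬-smallest (suc x) (∁ P ∘ toℕ) (¬? ∘ P? ∘ toℕ) (λ never → never (fromℕ x) (subst P (sym (toℕ-fromℕ x)) Px))
... | i , ¬¬Pi , below = toℕ i , decidable-stable (P? (toℕ i)) ¬¬Pi , i≤k
  where
  i≤k : ∀ {k} → P k → toℕ i ≤ k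
  i≤k Pk = ≮⇒≥ λ k<i → below (fromℕ< k<i) (subst P (sym (trans (toℕ-inject (fromℕ< k<i)) (toℕ-fromℕ< k<i))) Pk)

*-closed : ∀ (S : NumericalSemigroup) {x} → carrier S x → ∀ q → carrier S (q * x)
*-closed S x∈S zero    = has-zero S
*-closed S x∈S (suc q) = closed S x∈S (*-closed S x∈S q)

[m%d+n]%d≡[m+n]%d : ∀ m n d .{{_ : NonZero d}} → (m % d + n) % d ≡ (m + n) % d
[m%d+n]%d≡[m+n]%d m n d = begin
  (m % d + n) % d            ≡⟨ %-distribˡ-+ (m % d) n d ⟩
  (m % d % d + n % d) % d    ≡⟨ cong (λ r → (r + n % d) % d) (m%n%n≡m%n m d) ⟩
  (m % d + n % d) % d        ≡⟨ %-distribˡ-+ m n d ⟨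
  (m + n) % d                ∎
  where open ≡-Reasoning

m≤n∧m%d≡n%d⇒∃[q]n≡m+q*d : ∀ {m n} d .{{_ : NonZero d}} →
                          m ≤ n → m % d ≡ n % d → ∃ λ q → n ≡ m + q * d
m≤n∧m%d≡n%d⇒∃[q]n≡m+q*d {m} {n} d m≤n m%d≡n%d = n / d ∸ m / d , sym (begin
  m + (n / d ∸ m / d) * d                        ≡⟨ cong (_+ (n / d ∸ m / d) * d) (m≡m%n+[m/n]*n m d) ⟩
  (m % d + m / d * d) + (n / d ∸ m / d) * d      ≡⟨ +-assoc (m % d) _ _ ⟩
  m % d + (m / d * d + (n / d ∸ m / d) * d)      ≡⟨ cong (m % d +_) (*-distribʳ-+ d (m / d) _) ⟨
  m % d + (m / d + (n / d ∸ m / d)) * d          ≡⟨ cong (λ q → m % d + q * d) (m+[n∸m]≡n (/-monoˡ-≤ d m≤n)) ⟩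
  m % d + n / d * d                              ≡⟨ cong (_+ n / d * d) m%d≡n%d ⟩
  n % d + n / d * d                              ≡⟨ m≡m%n+[m/n]*n n d ⟨
  n                                              ∎)
  where open ≡-Reasoning

module Apéry (S : NumericalSemigroup) {d : ℕ} .{{_ : NonZero d}} (d∈S : carrier S d) where

  rotate : Fin d → Fin d
  rotate i = suc (toℕ i) mod d

  toℕ-iterate-rotate : ∀ i n → toℕ (iterate rotate i n) ≡ (toℕ i + n) % d
  toℕ-iterate-rotate i zero    = sym (trans (cong (_% d) (+-identityʳ (toℕ i))) (m<n⇒m%n≡m (toℕ<n i)))
  toℕ-iterate-rotate i (suc n) = begin
    toℕ (iterate rotate (rotate i) n)  ≡⟨ toℕ-iterate-rotate (rotate i) n ⟩
    (toℕ (rotate i) + n) % d           ≡⟨ cong (λ r → (r + n) % d) (toℕ-fromℕ< (m%n<n (suc (toℕ i)) d)) ⟩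
    (suc (toℕ i) % d + n) % d          ≡⟨ [m%d+n]%d≡[m+n]%d (suc (toℕ i)) n d ⟩
    (suc (toℕ i) + n) % d              ≡⟨ cong (_% d) (+-suc (toℕ i) n) ⟨
    (toℕ i + suc n) % d                ∎
    where open ≡-Reasoning

  InClass : Fin d → ℕ → Set
  InClass i x = carrier S x × x % d ≡ toℕ i

  least-in-class : ∀ i → Σ ℕ λ w → InClass i w × (∀ {x} → InClass i x → w ≤ x)
  least-in-class i = least (λ x → member? S x ×-dec (x % d ℕ.≟ toℕ i)) (large∈S , large-class)
    where
    N = proj₁ (cofinite S)
    large∈S : carrier S (toℕ i + N * d)
    large∈S = proj₂ (cofinite S) _ (≤-trans (m≤m*n N d) (m≤n+m (N * d) (toℕ i)))
    large-class : (toℕ i + N * d) % d ≡ toℕ i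
    large-class = trans ([m+kn]%n≡m%n (toℕ i) N d) (m<n⇒m%n≡m (toℕ<n i))

  apéry : Fin d → ℕ
  apéry i = proj₁ (least-in-class i)

  apéry∈S : ∀ i → carrier S (apéry i)
  apéry∈S i = proj₁ (proj₁ (proj₂ (least-in-class i)))

  apéry-class : ∀ i → apéry i % d ≡ toℕ i
  apéry-class i = proj₂ (proj₁ (proj₂ (least-in-class i)))

  apéry-least : ∀ i {x} → carrier S x → x % d ≡ toℕ i → apéry i ≤ x
  apéry-least i x∈S x-class = proj₂ (proj₂ (least-in-class i)) (x∈S , x-class)

  apéryMap : WeightedMap d
  apéryMap = record { step = rotate ; height = apéry }

  admissible⇔∈ : ∀ n → Admissible apéryMap n ⇔ carrier S n
  admissible⇔∈ n = mk⇔ to from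
    where
    from : carrier S n → Admissible apéryMap n
    from n∈S x = apéry-least (iterate rotate x n) (closed S n∈S (apéry∈S x)) (begin
      (n + apéry x) % d          ≡⟨ cong (_% d) (+-comm n (apéry x)) ⟩
      (apéry x + n) % d          ≡⟨ [m%d+n]%d≡[m+n]%d (apéry x) n d ⟨
      (apéry x % d + n) % d      ≡⟨ cong (λ r → (r + n) % d) (apéry-class x) ⟩
      (toℕ x + n) % d            ≡⟨ toℕ-iterate-rotate x n ⟨
      toℕ (iterate rotate x n)   ∎)
      where open ≡-Reasoning
    to : Admissible apéryMap n → carrier S n
    to adm = subst (carrier S) (sym n≡apéry-j+q*d) (closed S (apéry∈S j) (*-closed S d∈S q))
      where
      origin : Fin d
      origin = fromℕ< (>-nonZero⁻¹ d)
      toℕ-origin : toℕ origin ≡ 0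
      toℕ-origin = toℕ-fromℕ< (>-nonZero⁻¹ d)
      apéry-origin : apéry origin ≡ 0
      apéry-origin =
        n≤0⇒n≡0 (apéry-least origin (has-zero S) (trans (m<n⇒m%n≡m (>-nonZero⁻¹ d)) (sym toℕ-origin)))
      j = iterate rotate origin n
      apéry-j≤n : apéry j ≤ n
      apéry-j≤n = subst (apéry j ≤_) (trans (cong (n +_) apéry-origin) (+-identityʳ n)) (adm origin)
      apéry-j-class : apéry j % d ≡ n % d
      apéry-j-class =
        trans (apéry-class j) (trans (toℕ-iterate-rotate origin n) (cong (λ r → (r + n) % d) toℕ-origin))
      q = proj₁ (m≤n∧m%d≡n%d⇒∃[q]n≡m+q*d d apéry-j≤n apéry-j-class)
      n≡apéry-j+q*d = proj₂ (m≤n∧m%d≡n%d⇒∃[q]n≡m+q*d d apéry-j≤n apéry-j-class)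

∀-cong-⇔ : ∀ {a b c} {I : Set a} {P : I → Set b} {Q : I → Set c} →
           (∀ i → P i ⇔ Q i) → (∀ i → P i) ⇔ (∀ i → Q i)
∀-cong-⇔ P⇔Q = mk⇔ (λ p i → to (P⇔Q i) (p i)) (λ q i → from (P⇔Q i) (q i))
  where open Equivalence

theorem2p5 : (k : ℕ) (S : Fin k → NumericalSemigroup) (d : Fin k → ℕ)
    → (∀ i → carrier (S i) (d i)) → (∀ i → d i ≢ 0)
    → Σ (Mat ℚ (∑ d)) λ A → ∀ n → (𝒮 A n ⇔ (∀ i → carrier (S i) n))
theorem2p5 k S d d∈S d≢0 = matrix (⨁ apéryMaps) , λ n → begin
  𝒮 (matrix (⨁ apéryMaps)) n          ∼⟨ 𝒮-matrix (⨁ apéryMaps) n ⟩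
  Admissible (⨁ apéryMaps) n          ∼⟨ admissible-⨁ apéryMaps n ⟩
  (∀ i → Admissible (apéryMaps i) n)  ∼⟨ ∀-cong-⇔ (λ i → admissible⇔∈ i n) ⟩
  (∀ i → carrier (S i) n)             ∎
  where
  open EquationalReasoning
  apéryMaps : (i : Fin k) → WeightedMap (d i)
  apéryMaps i = Apéry.apéryMap (S i) {{≢-nonZero (d≢0 i)}} (d∈S i)
  admissible⇔∈ : ∀ i n → Admissible (apéryMaps i) n ⇔ carrier (S i) n
  admissible⇔∈ i = Apéry.admissible⇔∈ (S i) {{≢-nonZero (d≢0 i)}} (d∈S i)
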